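{- Let $n \geq 2$ and $m \geq 1$ be integers. Then $K_{1,n} + \overline{K_m}$ is super edge-magic if and only if $m = 1$.
   Context: All graphs are finite and simple. For a graph $G$ with $p=|V(G)|$ vertices and $q=|E(G)|$ edges, a super edge-magic labeling is a bijection $f: V(G)\cup E(G)\to\{1,2,\ldots,p+q\}$ with $f(V(G))=\{1,\ldots,p\}$ such that $f(x)+f(xy)+f(y)$ is the same constant for every edge $xy$; $G$ is super edge-magic if it has such a labeling. The join $G_1+G_2$ of two vertex-disjoint graphs is their union together with all edges joining a vertex of $G_1$ to a vertex of $G_2$. $K_{1,n}$ is the star with center $c$ and leaves $x_1,\ldots,x_n$, and $\overline{K_m}$ is the graph with $m$ vertices $y_1,\ldots,y_m$ and no edges; so $K_{1,n}+\overline{K_m}$ has edges $cx_i$, $x_iy_j$ and $cy_j$ for $1\le i\le n$, $1\le j\le m$. -}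

module Defs where

open import Data.Nat using (ℕ; suc; _+_; _*_; _<_; _≤_)
open import Data.Fin using (Fin; toℕ)
open import Data.Unit using (⊤; tt)
open import Data.Sum using (_⊎_; inj₁; inj₂)
open import Data.Product using (_×_; _,_; Σ; ∃)
open import Relation.Binary.PropositionalEquality using (_≡_)
open import Function.Bundles using (_⤖_; Bijection)

record Graph : Set₁ where
  field
    V     : Set
    E     : Set
    p     : ℕ
    q     : ℕ
    ends  : E → V × V

open Graph public

label : ∀ {A : Set} {N : ℕ} → A ⤖ Fin N → A → ℕ
label f a = suc (toℕ (Bijection.to f a))

record SuperEdgeMagicLabeling (G : Graph) : Set where
  field
    f        : (V G ⊎ E G) ⤖ Fin (p G + q G)
    vert≤p   : ∀ v → label f (inj₁ v) ≤ p G
    vertOnto : ∀ (k : ℕ) → k < p G → Σ (V G) (λ v → label f (inj₁ v) ≡ suc k)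
    const    : ℕ
    magic    : ∀ e → let (x , y) = ends G e in
                 label f (inj₁ x) + label f (inj₂ e) + label f (inj₁ y) ≡ const

SuperEdgeMagic : Graph → Set
SuperEdgeMagic G = SuperEdgeMagicLabeling G

-- K_{1,n} + \overline{K_m}:
-- vertices: c = inj₁ tt, x_i = inj₂ (inj₁ i), y_j = inj₂ (inj₂ j)
-- edges:    c x_i = inj₁ i,  x_i y_j = inj₂ (inj₁ (i , j)),  c y_j = inj₂ (inj₂ j)
K1n+Km̄ : ℕ → ℕ → Graph
K1n+Km̄ n m = record
  { V    = ⊤ ⊎ (Fin n ⊎ Fin m)
  ; E    = Fin n ⊎ ((Fin n × Fin m) ⊎ Fin m)
  ; p    = 1 + n + m
  ; q    = n + n * m + m
  ; ends = λ { (inj₁ i)              → (inj₁ tt , inj₂ (inj₁ i))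
             ; (inj₂ (inj₁ (i , j))) → (inj₂ (inj₁ i) , inj₂ (inj₂ j))
             ; (inj₂ (inj₂ j))       → (inj₁ tt , inj₂ (inj₂ j)) }
  }

module Submission where

-- In a super edge-magic labeling the label of an edge xy is the magic constant minus f(x) + f(y),
-- so the q edges have pairwise distinct sums f(x) + f(y) of two distinct labels from 1, …, p.
-- These sums lie in 3, …, 2p − 1, whence q ≤ 2p − 3.  For K_{1,n} + K̄_m we have p = 1 + n + m
-- and q = n + nm + m, and q − (2p − 3) = (n − 1)(m − 1) > 0 once n, m ≥ 2.  For m = 1 an explicit
-- labeling works.

open import Defs
open import Data.Nat using (ℕ; zero; suc; pred; _+_; _*_; _∸_; _≤_; _<_; z≤n; s≤s)
open import Data.Nat.Properties
open import Data.Nat.Tactic.RingSolver using (solve-∀)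
open import Data.Fin using (Fin; toℕ; fromℕ<; _↑ˡ_; _↑ʳ_; cast; opposite; combine)
open import Data.Fin.Patterns using (0F)
open import Data.Fin.Properties
  using (toℕ-injective; toℕ-fromℕ<; toℕ<n; toℕ-↑ˡ; toℕ-↑ʳ; ↑ʳ-injective; toℕ-cast; cast-involutive;
         toℕ-combine; opposite-prop; opposite-involutive; injective⇒≤; +↔⊎; *↔×; 1↔⊤)
open import Data.Sum using (_⊎_; inj₁; inj₂)
open import Data.Sum.Properties using (inj₁-injective; inj₂-injective)
open import Data.Sum.Algebra using (⊎-comm; ⊎-assoc)
open import Data.Sum.Function.Propositional using (_⊎-↔_)
open import Data.Product using (_,_; Σ; proj₁; proj₂)
open import Data.Empty using (⊥-elim)
open import Relation.Binary.Definitions using (tri<; tri≈; tri>)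
open import Relation.Binary.PropositionalEquality using (_≡_; refl; sym; trans; cong; cong₂; subst; _≢_; module ≡-Reasoning)
open import Function.Base using (_∘_)
open import Function.Definitions using (Injective)
open import Function.Bundles using (Bijection; Inverse; _↔_; _⇔_; mk⇔; mk↔ₛ′)
open import Function.Properties.Inverse using (↔-refl; ↔-sym; ↔⇒⤖)
open import Function.Construct.Composition using (_↔-∘_)

injective-into-interval⇒≤ : ∀ {k lo hi} (h : Fin k → ℕ) → Injective _≡_ _≡_ h →
                            (∀ i → lo ≤ h i) → (∀ i → h i < hi) → k ≤ hi ∸ lo
injective-into-interval⇒≤ {k} {lo} {hi} h h-inj lo≤ <hi = injective⇒≤ {f = shifted} shifted-injective
  where
  shifted : Fin k → Fin (hi ∸ lo)
  shifted i = fromℕ< (∸-monoˡ-< (<hi i) (lo≤ i))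

  shifted-injective : Injective _≡_ _≡_ shifted
  shifted-injective {i} {j} eq = h-inj (∸-cancelʳ-≡ (lo≤ i) (lo≤ j) (begin
    h i ∸ lo              ≡⟨ toℕ-fromℕ< _ ⟨
    toℕ (shifted i)       ≡⟨ cong toℕ eq ⟩
    toℕ (shifted j)       ≡⟨ toℕ-fromℕ< _ ⟩
    h j ∸ lo              ∎))
    where open ≡-Reasoning

distinct⇒3≤suc+suc : ∀ {a b} → a ≢ b → 3 ≤ suc a + suc b
distinct⇒3≤suc+suc {zero}  {zero}  a≢b = ⊥-elim (a≢b refl)
distinct⇒3≤suc+suc {zero}  {suc b} _   = s≤s (s≤s (s≤s z≤n))
distinct⇒3≤suc+suc {suc a} {b}     _   = s≤s (s≤s (≤-trans (s≤s z≤n) (≤-reflexive (sym (+-suc a b)))))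

distinct⇒+<n+n : ∀ {a b n} → a ≤ n → b ≤ n → a ≢ b → a + b < n + n
distinct⇒+<n+n {a} {b} {n} a≤n b≤n a≢b with <-cmp a b
... | tri< a<b _ _ = +-mono-<-≤ (<-≤-trans a<b b≤n) b≤n
... | tri≈ _ a≡b _ = ⊥-elim (a≢b a≡b)
... | tri> _ _ b<a = subst (_< n + n) (+-comm b a) (+-mono-<-≤ (<-≤-trans b<a a≤n) a≤n)

Loopless : Graph → Set
Loopless G = ∀ e → proj₁ (ends G e) ≢ proj₂ (ends G e)

module _ {G : Graph} (L : SuperEdgeMagicLabeling G) where
  open SuperEdgeMagicLabeling L
  open Bijection f using (to; injective; strictlySurjective)

  label-injective : ∀ {a b} → label f a ≡ label f b → a ≡ b
  label-injective = injective ∘ toℕ-injective ∘ suc-injective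

  edgeSum : E G → ℕ
  edgeSum e = label f (inj₁ (proj₁ (ends G e))) + label f (inj₁ (proj₂ (ends G e)))

  edge-label+edgeSum : ∀ e → label f (inj₂ e) + edgeSum e ≡ const
  edge-label+edgeSum e = trans (rearrange (label f (inj₁ x)) (label f (inj₂ e)) (label f (inj₁ y))) (magic e)
    where
    x = proj₁ (ends G e)
    y = proj₂ (ends G e)
    rearrange : ∀ a l b → l + (a + b) ≡ a + l + b
    rearrange = solve-∀

  edgeSum-injective : Injective _≡_ _≡_ edgeSum
  edgeSum-injective {e₁} {e₂} eq = inj₂-injective (label-injective (+-cancelʳ-≡ (edgeSum e₁) _ _ (begin
    label f (inj₂ e₁) + edgeSum e₁  ≡⟨ edge-label+edgeSum e₁ ⟩
    const                           ≡⟨ edge-label+edgeSum e₂ ⟨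
    label f (inj₂ e₂) + edgeSum e₂  ≡⟨ cong (label f (inj₂ e₂) +_) eq ⟨
    label f (inj₂ e₂) + edgeSum e₁  ∎)))
    where open ≡-Reasoning

  -- Labels beyond p belong to edges, because vertex labels are at most p.
  labelledEdge : (k : Fin (q G)) → Σ (E G) λ e → to (inj₂ e) ≡ p G ↑ʳ k
  labelledEdge k with strictlySurjective (p G ↑ʳ k)
  ... | inj₂ e , eq = e , eq
  ... | inj₁ v , eq = ⊥-elim (<⇒≱ (vert≤p v) (begin
    p G                      ≤⟨ m≤m+n (p G) (toℕ k) ⟩
    p G + toℕ k              ≡⟨ toℕ-↑ʳ (p G) k ⟨
    toℕ (p G ↑ʳ k)           ≡⟨ cong toℕ eq ⟨
    toℕ (to (inj₁ v))        ∎))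
    where open ≤-Reasoning

  labelledEdge-injective : Injective _≡_ _≡_ (proj₁ ∘ labelledEdge)
  labelledEdge-injective {k₁} {k₂} eq = ↑ʳ-injective (p G) k₁ k₂ (begin
    p G ↑ʳ k₁                       ≡⟨ proj₂ (labelledEdge k₁) ⟨
    to (inj₂ (proj₁ (labelledEdge k₁))) ≡⟨ cong (to ∘ inj₂) eq ⟩
    to (inj₂ (proj₁ (labelledEdge k₂))) ≡⟨ proj₂ (labelledEdge k₂) ⟩
    p G ↑ʳ k₂                       ∎)
    where open ≡-Reasoning

  superEdgeMagic⇒q≤2p∸3 : Loopless G → q G ≤ p G + p G ∸ 3
  superEdgeMagic⇒q≤2p∸3 loopless = injective-into-interval⇒≤ (edgeSum ∘ proj₁ ∘ labelledEdge)
    (labelledEdge-injective ∘ edgeSum-injective)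
    (λ k → distinct⇒3≤suc+suc (ends-labels-distinct (proj₁ (labelledEdge k))))
    (λ k → distinct⇒+<n+n (vert≤p _) (vert≤p _) (ends-labels-distinct (proj₁ (labelledEdge k)) ∘ cong pred))
    where
    ends-labels-distinct : ∀ e → toℕ (to (inj₁ (proj₁ (ends G e)))) ≢ toℕ (to (inj₁ (proj₂ (ends G e))))
    ends-labels-distinct e = loopless e ∘ inj₁-injective ∘ label-injective ∘ cong suc

superEdgeMagic-fromOrders : (G : Graph) (vertexOrder : V G ↔ Fin (p G)) (edgeOrder : E G ↔ Fin (q G)) (k : ℕ) →
  (∀ e → toℕ (Inverse.to vertexOrder (proj₁ (ends G e))) + toℕ (Inverse.to edgeOrder e)
           + toℕ (Inverse.to vertexOrder (proj₂ (ends G e))) ≡ k) →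
  SuperEdgeMagic G
superEdgeMagic-fromOrders G vertexOrder edgeOrder k sums≡k = record
  { f        = f
  ; vert≤p   = λ v → subst (_≤ p G) (sym (vertex-label v)) (toℕ<n (toV v))
  ; vertOnto = λ j j<p → fromV (fromℕ< j<p) , trans (vertex-label _)
                 (cong suc (trans (cong toℕ (strictlyInverseˡ _)) (toℕ-fromℕ< j<p)))
  ; const    = 3 + p G + k
  ; magic    = magic
  }
  where
  open Inverse vertexOrder using (strictlyInverseˡ) renaming (to to toV; from to fromV)
  open Inverse edgeOrder using () renaming (to to toE)
  open ≡-Reasoning

  f = ↔⇒⤖ (↔-sym +↔⊎ ↔-∘ (vertexOrder ⊎-↔ edgeOrder))

  vertex-label : ∀ v → label f (inj₁ v) ≡ suc (toℕ (toV v))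
  vertex-label v = cong suc (toℕ-↑ˡ (toV v) (q G))

  edge-label : ∀ e → label f (inj₂ e) ≡ suc (p G + toℕ (toE e))
  edge-label e = cong suc (toℕ-↑ʳ (p G) (toE e))

  magic : ∀ e → label f (inj₁ (proj₁ (ends G e))) + label f (inj₂ e) + label f (inj₁ (proj₂ (ends G e)))
                ≡ 3 + p G + k
  magic e = begin
    label f (inj₁ x) + label f (inj₂ e) + label f (inj₁ y)
      ≡⟨ cong₂ _+_ (cong₂ _+_ (vertex-label x) (edge-label e)) (vertex-label y) ⟩
    suc (toℕ (toV x)) + suc (p G + toℕ (toE e)) + suc (toℕ (toV y))
      ≡⟨ shift (toℕ (toV x)) (toℕ (toE e)) (toℕ (toV y)) (p G) ⟩
    3 + p G + (toℕ (toV x) + toℕ (toE e) + toℕ (toV y))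
      ≡⟨ cong (3 + p G +_) (sums≡k e) ⟩
    3 + p G + k ∎
    where
    x = proj₁ (ends G e)
    y = proj₂ (ends G e)
    shift : ∀ a b c P → suc a + suc (P + b) + suc c ≡ 3 + P + (a + b + c)
    shift = solve-∀

opposite↔ : ∀ {n} → Fin n ↔ Fin n
opposite↔ = mk↔ₛ′ opposite opposite opposite-involutive opposite-involutive

cast↔ : ∀ {m n} → m ≡ n → Fin m ↔ Fin n
cast↔ eq = mk↔ₛ′ (cast eq) (cast (sym eq)) (cast-involutive eq (sym eq)) (cast-involutive (sym eq) eq)

toℕ-opposite+suc : ∀ {n} (i : Fin n) → toℕ (opposite i) + suc (toℕ i) ≡ n
toℕ-opposite+suc i = trans (cong (_+ suc (toℕ i)) (opposite-prop i)) (m∸n+n≡m (toℕ<n i))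

-- In K_{1,n} + K_1 the centre gets 1, the leaf x_i gets n + 1 − i (counting i from 0) and y gets n + 2;
-- the edge labels are then forced, and run through x_i y, c y, c x_i in this order.
module K1n+K1 (n : ℕ) where
  G : Graph
  G = K1n+Km̄ n 1

  vertexOrder : V G ↔ Fin (p G)
  vertexOrder = ↔-sym (+↔⊎ {1} {n + 1}) ↔-∘ (↔-sym 1↔⊤ ⊎-↔ (↔-sym (+↔⊎ {n} {1}) ↔-∘ (opposite↔ ⊎-↔ ↔-refl)))

  edgeOrder : E G ↔ Fin (q G)
  edgeOrder = cast↔ (size n) ↔-∘ (↔-sym (+↔⊎ {n * 1} {1 + n}) ↔-∘ ((↔-sym *↔× ⊎-↔ ↔-sym (+↔⊎ {1} {n}))
              ↔-∘ (⊎-assoc _ _ _ _ ↔-∘ ⊎-comm _ _)))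
    where
    size : ∀ n → n * 1 + (1 + n) ≡ n + n * 1 + 1
    size = solve-∀

  open Inverse vertexOrder using () renaming (to to toV)
  open Inverse edgeOrder using () renaming (to to toE)
  open ≡-Reasoning

  toV-x : ∀ i → toℕ (toV (inj₂ (inj₁ i))) ≡ suc (toℕ (opposite i))
  toV-x i = cong suc (toℕ-↑ˡ (opposite i) 1)

  toV-y : toℕ (toV (inj₂ (inj₂ 0F))) ≡ suc n
  toV-y = cong suc (trans (toℕ-↑ʳ n 0F) (+-identityʳ n))

  toE-cx : ∀ i → toℕ (toE (inj₁ i)) ≡ suc (n + toℕ i)
  toE-cx i = begin
    toℕ (toE (inj₁ i))               ≡⟨ toℕ-cast _ _ ⟩
    toℕ (n * 1 ↑ʳ (1 ↑ʳ i))          ≡⟨ toℕ-↑ʳ (n * 1) _ ⟩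
    n * 1 + suc (toℕ i)              ≡⟨ cong (_+ suc (toℕ i)) (*-identityʳ n) ⟩
    n + suc (toℕ i)                  ≡⟨ +-suc n (toℕ i) ⟩
    suc (n + toℕ i)                  ∎

  toE-xy : ∀ i → toℕ (toE (inj₂ (inj₁ (i , 0F)))) ≡ toℕ i
  toE-xy i = begin
    toℕ (toE (inj₂ (inj₁ (i , 0F))))  ≡⟨ toℕ-cast _ _ ⟩
    toℕ (combine i 0F ↑ˡ (1 + n))     ≡⟨ toℕ-↑ˡ (combine i 0F) (1 + n) ⟩
    toℕ (combine i 0F)                ≡⟨ toℕ-combine i 0F ⟩
    1 * toℕ i + 0                     ≡⟨ trans (+-identityʳ _) (*-identityˡ _) ⟩
    toℕ i                             ∎

  toE-cy : toℕ (toE (inj₂ (inj₂ 0F))) ≡ n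
  toE-cy = trans (toℕ-cast _ _) (trans (toℕ-↑ʳ (n * 1) 0F) (trans (+-identityʳ _) (*-identityʳ n)))

  sums : ∀ e → toℕ (toV (proj₁ (ends G e))) + toℕ (toE e) + toℕ (toV (proj₂ (ends G e))) ≡ n + suc n
  sums (inj₁ i) = begin
    toℕ (toE (inj₁ i)) + toℕ (toV (inj₂ (inj₁ i)))  ≡⟨ cong₂ _+_ (toE-cx i) (toV-x i) ⟩
    suc (n + toℕ i) + suc (toℕ (opposite i))  ≡⟨ rearrange n (toℕ i) (toℕ (opposite i)) ⟩
    n + suc (toℕ (opposite i) + suc (toℕ i))  ≡⟨ cong (λ s → n + suc s) (toℕ-opposite+suc i) ⟩
    n + suc n                                 ∎
    where
    rearrange : ∀ n i o → suc (n + i) + suc o ≡ n + suc (o + suc i)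
    rearrange = solve-∀
  sums (inj₂ (inj₁ (i , 0F))) = begin
    toℕ (toV (inj₂ (inj₁ i))) + toℕ (toE (inj₂ (inj₁ (i , 0F)))) + toℕ (toV (inj₂ (inj₂ 0F)))
      ≡⟨ cong₂ _+_ (cong₂ _+_ (toV-x i) (toE-xy i)) toV-y ⟩
    suc (toℕ (opposite i)) + toℕ i + suc n    ≡⟨ cong (_+ suc n) (sym (+-suc _ _)) ⟩
    toℕ (opposite i) + suc (toℕ i) + suc n    ≡⟨ cong (_+ suc n) (toℕ-opposite+suc i) ⟩
    n + suc n                                 ∎
  sums (inj₂ (inj₂ 0F)) = cong₂ _+_ toE-cy toV-y

  superEdgeMagic : SuperEdgeMagic G
  superEdgeMagic = superEdgeMagic-fromOrders G vertexOrder edgeOrder (n + suc n) sums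

K1n+Km̄-loopless : ∀ n m → Loopless (K1n+Km̄ n m)
K1n+Km̄-loopless n m (inj₁ _)        ()
K1n+Km̄-loopless n m (inj₂ (inj₁ _)) ()
K1n+Km̄-loopless n m (inj₂ (inj₂ _)) ()

-- With n = 2 + a and m = 2 + b the excess q − (2p − 3) is (n − 1)(m − 1) = 1 + a + b + a b.
K1n+Km̄-2p∸3<q : ∀ a b → let G = K1n+Km̄ (2 + a) (2 + b) in p G + p G ∸ 3 < q G
K1n+Km̄-2p∸3<q a b = <-≤-trans (m<m+n _ 0<1+n) (≤-reflexive (sym (excess a b)))
  where
  -- p + p ∸ 3 reduces to a + (2 + b) + p.
  excess : ∀ a b → (2 + a) + (2 + a) * (2 + b) + (2 + b)
                 ≡ (a + (2 + b) + (1 + (2 + a) + (2 + b))) + suc (a * b + a + b)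
  excess = solve-∀

lemma4 : (n m : ℕ) → 2 ≤ n → 1 ≤ m →
    (SuperEdgeMagic (K1n+Km̄ n m) ⇔ (m ≡ 1))
lemma4 (suc (suc a)) 1 _ _ = mk⇔ (λ _ → refl) (λ { refl → K1n+K1.superEdgeMagic (2 + a) })
lemma4 (suc (suc a)) (suc (suc b)) _ _ = mk⇔ too-many-edges λ ()
  where
  too-many-edges : SuperEdgeMagic (K1n+Km̄ (2 + a) (2 + b)) → suc (suc b) ≡ 1
  too-many-edges L = ⊥-elim (<⇒≱ (K1n+Km̄-2p∸3<q a b) (superEdgeMagic⇒q≤2p∸3 L (K1n+Km̄-loopless _ _)))
lemma4 0                   _ ()          _
lemma4 1                   _ (s≤s ())    _
lemma4 (suc (suc _))       0 _           ()
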